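{- Let $\mathcal{C}\subseteq\mathbb{N}^d$ be a positive integer cone, $\preceq$ a term order on $\mathbb{N}^d$, $k\in\mathcal{C}$, and let $S\in\mathcal{P}(k)\setminus\operatorname{EI}(k)$. Then $S\setminus\{\beta(S)\}\in\mathcal{P}(k)$.
   Context: For a finite $A\subseteq\mathbb{N}^d$, the positive integer cone spanned by $A$ is $\mathcal{C}=\{\sum q_ia_i: a_i\in A, q_i\in\mathbb{Q}_{\geq0}\}\cap\mathbb{N}^d$. A $\mathcal{C}$-semigroup is a finitely generated submonoid $S\subseteq\mathcal{C}$ of $(\mathbb{N}^d,+)$ with $\mathcal{C}\setminus S$ finite; $\mathcal{H}(S)=\mathcal{C}\setminus S$; $\operatorname{msg}(S)$ is its minimal system of generators. $x\leq_{\mathcal{C}}y$ iff $y-x\in\mathcal{C}$; $\operatorname{Minimals}_{\leq_{\mathcal{C}}}$ denotes minimal elements. $\operatorname{I}_{\mathcal{C}}(k)=\{x\in\mathcal{C}: x\leq_{\mathcal{C}}k\}$. $S$ is $k$-positioned if $k-h\in S$ for all $h\in\mathcal{H}(S)$. $\operatorname{C}(S)=\{x\in\mathcal{C}: x\leq_{\mathcal{C}}h\text{ for some }h\in\mathcal{H}(S)\}$, $\operatorname{M}(S)=\{h\in\mathcal{H}(S):\{s\in S: h-s\in S\}=\{0\}\}\cup\{0\}$. $S$ is primary positioned for $k$ if it is $k$-positioned and $|\operatorname{M}(S)|+|\operatorname{C}(S)|=|\operatorname{I}_{\mathcal{C}}(k)|$; $\mathcal{P}(k)$ is the set of such $\mathcal{C}$-semigroups.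 A term order is a total order $\preceq$ on $\mathbb{N}^d$ with $0\preceq v$ and $u\preceq v\Rightarrow u+w\preceq v+w$; $\operatorname{F}_\preceq(S)=\max_\preceq\mathcal{H}(S)$; $\operatorname{PF}(S)=\{x\in\mathcal{H}(S): x+(S\setminus\{0\})\subseteq S\}$. $S$ is irreducible if $\operatorname{PF}(S)=\{\operatorname{F}_\preceq(S)\}$ or $\operatorname{PF}(S)=\{\operatorname{F}_\preceq(S),\operatorname{F}_\preceq(S)/2\}$; then $\operatorname{F}(S)$ is independent of $\preceq$. $\operatorname{EI}(k)=\{S\in\mathcal{P}(k): S=T'\cup\{k\}\text{ or }S=T'\cup\{\frac{k}{2},k\}\text{ for some irreducible }\mathcal{C}\text{ -semigroup }T'\text{ with }\operatorname{F}(T')=k\}$. $\operatorname{B}(S)=\{x\in\operatorname{msg}(S): x\in\operatorname{C}(S)\setminus\operatorname{Minimals}_{\leq_{\mathcal{C}}}(S\setminus\{0\}),\ k-x\in S,\ x\neq\frac{k}{2}\}$; for $S\in\mathcal{P}(k)\setminus\operatorname{EI}(k)$ this set is nonempty, and $\beta(S)=\max_\preceq\operatorname{B}(S)$. -}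

module Defs where

open import Level using (0ℓ) renaming (suc to lsuc)
open import Data.Nat as ℕ using (ℕ)
open import Data.Integer using (+_)
open import Data.Rational as ℚ using (ℚ; 0ℚ)
open import Data.Vec using (Vec; zipWith; replicate; lookup)
open import Data.Fin using (Fin)
open import Data.List using (List; []; _∷_; length; map; foldr)
open import Data.List.Relation.Unary.All using (All)
open import Data.List.Relation.Unary.Unique.Propositional using (Unique)
open import Data.List.Membership.Propositional using (_∈_)
open import Data.Product using (Σ; _×_; _,_)
open import Data.Sum using (_⊎_)
open import Relation.Nullary using (¬_)
open import Relation.Unary using (Pred)
open import Relation.Binary using (Rel; IsTotalOrder)
open import Relation.Binary.PropositionalEquality using (_≡_; _≢_)

Pt : ℕ → Set
Pt d = Vec ℕ d

_⊕_ : ∀ {d} → Pt d → Pt d → Pt d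
x ⊕ y = zipWith ℕ._+_ x y

𝟎 : ∀ {d} → Pt d
𝟎 = replicate _ 0

Subset : ℕ → Set₁
Subset d = Pred (Pt d) 0ℓ

_⇔_ : Set → Set → Set
P ⇔ Q = (P → Q) × (Q → P)

ℕ→ℚ : ℕ → ℚ
ℕ→ℚ n = (+ n) ℚ./ 1

sumℚ : List ℚ → ℚ
sumℚ = foldr ℚ._+_ 0ℚ

-- x ∈ cone spanned by A over ℚ≥0, intersected with ℕ^d:
-- x = Σ q_i a_i with a_i ∈ A and q_i ∈ ℚ≥0 (coordinatewise in ℚ)
InCone : ∀ {d} → List (Pt d) → Pt d → Set
InCone {d} A x =
  Σ (List (ℚ × Pt d)) λ cs →
    All (λ { (q , a) → (0ℚ ℚ.≤ q) × (a ∈ A) }) cs ×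
    (∀ (j : Fin d) → ℕ→ℚ (lookup x j) ≡ sumℚ (map (λ { (q , a) → q ℚ.* ℕ→ℚ (lookup a j) }) cs))

data Generated {d} (G : List (Pt d)) : Pt d → Set where
  gen-zero : Generated G 𝟎
  gen-add  : ∀ {g x} → g ∈ G → Generated G x → Generated G (g ⊕ x)

HasCard : ∀ {d} → Subset d → ℕ → Set
HasCard {d} X n =
  Σ (List (Pt d)) λ L → Unique L × (∀ x → X x ⇔ (x ∈ L)) × (length L ≡ n)

record TermOrder (d : ℕ) : Set₁ where
  field
    _≼_          : Rel (Pt d) 0ℓ
    isTotalOrder : IsTotalOrder _≡_ _≼_
    zero≼        : ∀ v → 𝟎 ≼ v
    compat       : ∀ {u v} w → u ≼ v → (u ⊕ w) ≼ (v ⊕ w)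

module Theory {d : ℕ} (A : List (Pt d)) (T : TermOrder d) where
  open TermOrder T using (_≼_)

  C : Subset d
  C = InCone A

  _≤C_ : Pt d → Pt d → Set
  x ≤C y = Σ (Pt d) λ z → C z × (y ≡ x ⊕ z)

  Hole : Subset d → Subset d
  Hole S x = C x × ¬ S x

  record IsCSemigroup (S : Subset d) : Set where
    field
      zero∈    : S 𝟎
      closed   : ∀ {x y} → S x → S y → S (x ⊕ y)
      ⊆C       : ∀ {x} → S x → C x
      fingen   : Σ (List (Pt d)) λ G → All S G × (∀ {x} → S x → Generated G x)
      finHoles : Σ (List (Pt d)) λ L → ∀ {x} → Hole S x → x ∈ L

  Msg : Subset d → Subset d
  Msg S x = S x × x ≢ 𝟎 ×
    ¬ (Σ (Pt d) λ y → Σ (Pt d) λ z → S y × y ≢ 𝟎 × S z × z ≢ 𝟎 × x ≡ y ⊕ z)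

  Minimal : Subset d → Subset d
  Minimal S x = S x × x ≢ 𝟎 × (∀ y → S y → y ≢ 𝟎 → y ≤C x → y ≡ x)

  I : Pt d → Subset d
  I k x = C x × x ≤C k

  Positioned : Pt d → Subset d → Set
  Positioned k S = ∀ h → Hole S h → Σ (Pt d) λ s → S s × (k ≡ h ⊕ s)

  CS : Subset d → Subset d
  CS S x = C x × Σ (Pt d) λ h → Hole S h × x ≤C h

  -- M(S) (h - s ranges over H(S))
  MS : Subset d → Subset d
  MS S x = (Hole S x × (∀ s → S s → (Σ (Pt d) λ t → Hole S t × x ≡ s ⊕ t) → s ≡ 𝟎))
           ⊎ (x ≡ 𝟎)

  P : Pt d → Subset d → Set
  P k S = IsCSemigroup S × Positioned k S ×
    (Σ ℕ λ a → Σ ℕ λ b → Σ ℕ λ c →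
       HasCard (MS S) a × HasCard (CS S) b × HasCard (I k) c × (a ℕ.+ b ≡ c))

  IsFrob : Subset d → Pt d → Set
  IsFrob S f = Hole S f × (∀ h → Hole S h → h ≼ f)

  PF : Subset d → Subset d
  PF S x = Hole S x × (∀ s → S s → s ≢ 𝟎 → S (x ⊕ s))

  Irreducible : Subset d → Set
  Irreducible S = Σ (Pt d) λ f → IsFrob S f ×
    ((∀ x → PF S x ⇔ (x ≡ f)) ⊎
     (Σ (Pt d) λ h → (h ⊕ h ≡ f) × (∀ x → PF S x ⇔ ((x ≡ f) ⊎ (x ≡ h)))))

  EI : Pt d → Subset d → Set₁
  EI k S = P k S × Σ (Subset d) λ T' → IsCSemigroup T' × Irreducible T' × IsFrob T' k ×
    ((∀ x → S x ⇔ (T' x ⊎ x ≡ k)) ⊎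
     (Σ (Pt d) λ h → (h ⊕ h ≡ k) × (∀ x → S x ⇔ (T' x ⊎ (x ≡ h ⊎ x ≡ k)))))

  B : Pt d → Subset d → Subset d
  B k S x = Msg S x × CS S x × ¬ Minimal S x ×
    (Σ (Pt d) λ s → S s × (k ≡ x ⊕ s)) × ¬ (x ⊕ x ≡ k)

  Remove : Subset d → Pt d → Subset d
  Remove S b x = S x × x ≢ b

{-# OPTIONS --safe #-}
-- Removing the minimal generator β from S adds the single hole β, so S ∖ {β} is again a
-- C-semigroup, still k-positioned because k − β ∈ S and β ≠ k/2.  C(S) is unchanged since
-- β lies below a hole of S, and M(S) is unchanged since β is not ≤_C-minimal in S ∖ {0}:
-- then β, and β + t for every hole t of S, split off a nonzero element of S ∖ {β} with a
-- hole of S ∖ {β} as remainder.  So |M| + |C| = |I_C(k)| persists.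
module Submission where

open import Defs
open import Data.Nat as ℕ using (ℕ)
import Data.Nat.Properties as ℕ
import Data.Nat.Coprimality as Coprime
open import Data.Integer as ℤ using (+_)
import Data.Integer.Properties as ℤ
open import Data.Rational as ℚ using (ℚ; mkℚ; _/_)
open import Data.Rational.Properties using (↥p/↧p≡p; +-identityˡ; +-assoc)
open import Data.Vec using ([]; _∷_; lookup)
open import Data.Vec.Properties
  using (≡-dec; ∷-injectiveˡ; ∷-injectiveʳ; lookup-zipWith; zipWith-comm; zipWith-assoc;
         zipWith-identityˡ; zipWith-identityʳ)
open import Data.List using (List; []; _∷_; _++_; map; filter)
open import Data.List.Properties using (map-++)
open import Data.List.Relation.Unary.All as All using (All)
open import Data.List.Relation.Unary.All.Properties using (++⁺)
open import Data.List.Relation.Unary.Any using (here; there)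
open import Data.List.Membership.Propositional using (_∈_)
open import Data.List.Membership.Propositional.Properties
  using (∈-filter⁺; ∈-filter⁻; ∈-++⁺ˡ; ∈-++⁺ʳ; ∈-++⁻; ∈-map⁺; ∈-map⁻)
open import Data.Product using (Σ; _×_; _,_; proj₁; proj₂)
open import Data.Sum using (_⊎_; inj₁; inj₂)
open import Data.Empty using (⊥-elim)
open import Relation.Nullary using (¬_; yes; no)
open import Relation.Nullary.Decidable using (¬?; _×-dec_)
open import Relation.Unary using (Decidable)
open import Relation.Binary.PropositionalEquality
open import Relation.Binary.Definitions using (DecidableEquality)
open import Function using (_∘_)
open ≡-Reasoning

module _ {d : ℕ} where

  _≟ₚ_ : DecidableEquality (Pt d)
  _≟ₚ_ = ≡-dec ℕ._≟_

  ⊕-comm : (x y : Pt d) → x ⊕ y ≡ y ⊕ x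
  ⊕-comm = zipWith-comm ℕ.+-comm

  ⊕-assoc : (x y z : Pt d) → (x ⊕ y) ⊕ z ≡ x ⊕ (y ⊕ z)
  ⊕-assoc = zipWith-assoc ℕ.+-assoc

  ⊕-identityˡ : (x : Pt d) → 𝟎 ⊕ x ≡ x
  ⊕-identityˡ = zipWith-identityˡ ℕ.+-identityˡ

  ⊕-identityʳ : (x : Pt d) → x ⊕ 𝟎 ≡ x
  ⊕-identityʳ = zipWith-identityʳ ℕ.+-identityʳ

⊕-cancelˡ : ∀ {d} (x : Pt d) {y z} → x ⊕ y ≡ x ⊕ z → y ≡ z
⊕-cancelˡ [] {[]} {[]} _ = refl
⊕-cancelˡ (a ∷ x) {b ∷ y} {c ∷ z} eq =
  cong₂ _∷_ (ℕ.+-cancelˡ-≡ a b c (∷-injectiveˡ eq)) (⊕-cancelˡ x (∷-injectiveʳ eq))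

⊕-conicalˡ : ∀ {d} (x y : Pt d) → x ⊕ y ≡ 𝟎 → x ≡ 𝟎
⊕-conicalˡ [] [] _ = refl
⊕-conicalˡ (a ∷ x) (b ∷ y) eq =
  cong₂ _∷_ (ℕ.m+n≡0⇒m≡0 a (∷-injectiveˡ eq)) (⊕-conicalˡ x y (∷-injectiveʳ eq))

x⊕y≡x⇒y≡𝟎 : ∀ {d} {x y : Pt d} → x ⊕ y ≡ x → y ≡ 𝟎
x⊕y≡x⇒y≡𝟎 {x = x} eq = ⊕-cancelˡ x (trans eq (sym (⊕-identityʳ x)))

-- ℚ addition only computes on literals in normal form, so ℕ→ℚ n is first rewritten as one.
ℕ→ℚ-+ : ∀ m n → ℕ→ℚ (m ℕ.+ n) ≡ ℕ→ℚ m ℚ.+ ℕ→ℚ n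
ℕ→ℚ-+ m n = begin
  + (m ℕ.+ n) / 1                       ≡⟨ cong (_/ 1) (sym (cong₂ ℤ._+_ (ℤ.*-identityʳ (+ m)) (ℤ.*-identityʳ (+ n)))) ⟩
  (+ m ℤ.* + 1 ℤ.+ + n ℤ.* + 1) / 1     ≡⟨⟩
  normalised m ℚ.+ normalised n         ≡⟨ sym (cong₂ ℚ._+_ (↥p/↧p≡p (normalised m)) (↥p/↧p≡p (normalised n))) ⟩
  ℕ→ℚ m ℚ.+ ℕ→ℚ n                       ∎
  where
  normalised : ℕ → ℚ
  normalised k = mkℚ (+ k) 0 (Coprime.sym (Coprime.1-coprimeTo k))

sumℚ-++ : ∀ xs ys → sumℚ (xs ++ ys) ≡ sumℚ xs ℚ.+ sumℚ ys
sumℚ-++ []       ys = sym (+-identityˡ (sumℚ ys))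
sumℚ-++ (x ∷ xs) ys = trans (cong (x ℚ.+_) (sumℚ-++ xs ys)) (sym (+-assoc x (sumℚ xs) (sumℚ ys)))

InCone-⊕ : ∀ {d} (A : List (Pt d)) {x y : Pt d} → InCone A x → InCone A y → InCone A (x ⊕ y)
InCone-⊕ A {x} {y} (cs , cs∈A , x≡Σcs) (ds , ds∈A , y≡Σds) = cs ++ ds , ++⁺ cs∈A ds∈A , λ j → begin
  ℕ→ℚ (lookup (x ⊕ y) j)                 ≡⟨ cong ℕ→ℚ (lookup-zipWith ℕ._+_ j x y) ⟩
  ℕ→ℚ (lookup x j ℕ.+ lookup y j)        ≡⟨ ℕ→ℚ-+ (lookup x j) (lookup y j) ⟩
  ℕ→ℚ (lookup x j) ℚ.+ ℕ→ℚ (lookup y j)  ≡⟨ cong₂ ℚ._+_ (x≡Σcs j) (y≡Σds j) ⟩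
  sumℚ (map _ cs) ℚ.+ sumℚ (map _ ds)    ≡⟨ sym (sumℚ-++ (map _ cs) (map _ ds)) ⟩
  sumℚ (map _ cs ++ map _ ds)            ≡⟨ cong sumℚ (sym (map-++ _ cs ds)) ⟩
  sumℚ (map _ (cs ++ ds))                ∎

gen-⊕ : ∀ {d} {G : List (Pt d)} {x y} → Generated G x → Generated G y → Generated G (x ⊕ y)
gen-⊕ {y = y} gen-zero gy = subst (Generated _) (sym (⊕-identityˡ y)) gy
gen-⊕ {y = y} (gen-add {g} {x} g∈G gx) gy =
  subst (Generated _) (sym (⊕-assoc g x y)) (gen-add g∈G (gen-⊕ gx gy))

gen-∈ : ∀ {d} {G : List (Pt d)} {g} → g ∈ G → Generated G g
gen-∈ {g = g} g∈G = subst (Generated _) (⊕-identityʳ g) (gen-add g∈G gen-zero)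

HasCard-cong : ∀ {d} {X Y : Subset d} {n} → (∀ x → X x ⇔ Y x) → HasCard X n → HasCard Y n
HasCard-cong {Y = Y} X⇔Y (L , unique , X⇔L , length≡n) =
  L , unique , Y⇔L , length≡n
  where
  Y⇔L : ∀ x → Y x ⇔ (x ∈ L)
  Y⇔L x = (λ y → proj₁ (X⇔L x) (proj₂ (X⇔Y x) y)) , (λ x∈L → proj₁ (X⇔Y x) (proj₂ (X⇔L x) x∈L))

-- 2β and 3β generate every multiple nβ with n ≥ 2.
module WithoutGenerator {d : ℕ} (G : List (Pt d)) (β : Pt d) where

  Kept : Pt d → Set
  Kept g = g ≢ β × g ≢ 𝟎

  kept? : Decidable Kept
  kept? g = ¬? (g ≟ₚ β) ×-dec ¬? (g ≟ₚ 𝟎)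

  G₀ : List (Pt d)
  G₀ = filter kept? G

  ∈G₀⁻ : ∀ {g} → g ∈ G₀ → g ∈ G × Kept g
  ∈G₀⁻ = ∈-filter⁻ kept? {xs = G}

  G' : List (Pt d)
  G' = G₀ ++ map (β ⊕_) G₀ ++ (β ⊕ β) ∷ (β ⊕ (β ⊕ β)) ∷ []

  data Shape : Pt d → Set where
    kept    : ∀ {g} → g ∈ G₀ → Shape g
    shifted : ∀ {g} → g ∈ G₀ → Shape (β ⊕ g)
    twice   : Shape (β ⊕ β)
    thrice  : Shape (β ⊕ (β ⊕ β))

  shape : ∀ {g} → g ∈ G' → Shape g
  shape g∈G' with ∈-++⁻ G₀ g∈G'
  ... | inj₁ g∈G₀ = kept g∈G₀
  ... | inj₂ g∈rest with ∈-++⁻ (map (β ⊕_) G₀) g∈rest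
  ...   | inj₁ g∈map with ∈-map⁻ (β ⊕_) g∈map
  ...     | _ , g₀∈G₀ , refl = shifted g₀∈G₀
  shape _ | inj₂ _ | inj₂ (here refl)         = twice
  shape _ | inj₂ _ | inj₂ (there (here refl)) = thrice

  shape-∈ : ∀ {g} → Shape g → g ∈ G'
  shape-∈ (kept g∈G₀)    = ∈-++⁺ˡ g∈G₀
  shape-∈ (shifted g∈G₀) = ∈-++⁺ʳ G₀ (∈-++⁺ˡ (∈-map⁺ (β ⊕_) g∈G₀))
  shape-∈ twice          = ∈-++⁺ʳ G₀ (∈-++⁺ʳ (map (β ⊕_) G₀) (here refl))
  shape-∈ thrice         = ∈-++⁺ʳ G₀ (∈-++⁺ʳ (map (β ⊕_) G₀) (there (here refl)))

  gen-shape : ∀ {g} → Shape g → Generated G' g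
  gen-shape = gen-∈ ∘ shape-∈

  gen-β⊕-shape : ∀ {g} → Shape g → Generated G' (β ⊕ g)
  gen-β⊕-shape (kept g∈G₀)        = gen-shape (shifted g∈G₀)
  gen-β⊕-shape (shifted {g} g∈G₀) =
    subst (Generated G') (⊕-assoc β β g) (gen-⊕ (gen-shape twice) (gen-shape (kept g∈G₀)))
  gen-β⊕-shape twice              = gen-shape thrice
  gen-β⊕-shape thrice             =
    subst (Generated G') (⊕-assoc β β (β ⊕ β)) (gen-⊕ (gen-shape twice) (gen-shape twice))

  gen-β⊕ : ∀ {x} → Generated G' x → Generated G' (β ⊕ x) ⊎ β ⊕ x ≡ β
  gen-β⊕ gen-zero                  = inj₂ (⊕-identityʳ β)
  gen-β⊕ (gen-add {g} {x} g∈G' gx) =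
    inj₁ (subst (Generated G') (⊕-assoc β g x) (gen-⊕ (gen-β⊕-shape (shape g∈G')) gx))

  generated-or-β : ∀ {x} → Generated G x → Generated G' x ⊎ x ≡ β
  generated-or-β gen-zero = inj₁ gen-zero
  generated-or-β (gen-add {g} {x} g∈G gx) with g ≟ₚ β | g ≟ₚ 𝟎 | generated-or-β gx
  ... | yes refl | _        | inj₁ gx'  = gen-β⊕ gx'
  ... | yes refl | _        | inj₂ refl = inj₁ (gen-shape twice)
  ... | no _     | yes refl | x'        = subst (λ y → Generated G' y ⊎ y ≡ β) (sym (⊕-identityˡ x)) x'
  ... | no g≢β   | no g≢𝟎   | inj₁ gx'  = inj₁ (gen-add (shape-∈ (kept (∈-filter⁺ kept? g∈G (g≢β , g≢𝟎)))) gx')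
  ... | no g≢β   | no g≢𝟎   | inj₂ refl =
    inj₁ (subst (Generated G') (⊕-comm β g) (gen-shape (shifted (∈-filter⁺ kept? g∈G (g≢β , g≢𝟎)))))

  generated-without : ∀ {x} → Generated G x → x ≢ β → Generated G' x
  generated-without gx x≢β with generated-or-β gx
  ... | inj₁ gx'  = gx'
  ... | inj₂ x≡β  = ⊥-elim (x≢β x≡β)

  All-without : (S : Subset d) → All S G → S β → (∀ {x y} → S x → S y → S (x ⊕ y)) → β ≢ 𝟎 →
                All (λ g → S g × g ≢ β) G'
  All-without S G⊆S β∈S closed β≢𝟎 = All.tabulate (λ g∈G' → shape-without (shape g∈G'))
    where
    ∈S : ∀ {g} → g ∈ G₀ → S g
    ∈S g∈G₀ = All.lookup G⊆S (proj₁ (∈G₀⁻ g∈G₀))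

    shape-without : ∀ {g} → Shape g → S g × g ≢ β
    shape-without (kept g∈G₀)    = ∈S g∈G₀ , proj₁ (proj₂ (∈G₀⁻ g∈G₀))
    shape-without (shifted g∈G₀) =
      closed β∈S (∈S g∈G₀) , λ eq → proj₂ (proj₂ (∈G₀⁻ g∈G₀)) (x⊕y≡x⇒y≡𝟎 eq)
    shape-without twice          = closed β∈S β∈S , λ eq → β≢𝟎 (x⊕y≡x⇒y≡𝟎 eq)
    shape-without thrice         =
      closed β∈S (closed β∈S β∈S) , λ eq → β≢𝟎 (⊕-conicalˡ β β (x⊕y≡x⇒y≡𝟎 eq))

module _ {d : ℕ} (A : List (Pt d)) (T : TermOrder d) where
  open Theory A T

  ≤C-trans : ∀ {x y z} → x ≤C y → y ≤C z → x ≤C z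
  ≤C-trans {x} (u , u∈C , y≡x⊕u) (v , v∈C , z≡y⊕v) =
    u ⊕ v , InCone-⊕ A {u} {v} u∈C v∈C , trans z≡y⊕v (trans (cong (_⊕ v) y≡x⊕u) (⊕-assoc x u v))

  SplitsTrivially : Subset d → Pt d → Set
  SplitsTrivially S h = ∀ s → S s → (Σ (Pt d) λ t → Hole S t × h ≡ s ⊕ t) → s ≡ 𝟎

  module Removal (S : Subset d) (S-cs : IsCSemigroup S) (β : Pt d) (β∈msg : Msg S β) where
    open IsCSemigroup S-cs

    private
      S' : Subset d
      S' = Remove S β

      β∈S : S β
      β∈S = proj₁ β∈msg

      β≢𝟎 : β ≢ 𝟎
      β≢𝟎 = proj₁ (proj₂ β∈msg)

    Hole-Remove⁺ : ∀ {h} → Hole S h → Hole S' h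
    Hole-Remove⁺ (h∈C , h∉S) = h∈C , λ h∈S' → h∉S (proj₁ h∈S')

    Hole-Remove⁻ : ∀ {h} → Hole S' h → h ≢ β → Hole S h
    Hole-Remove⁻ (h∈C , h∉S') h≢β = h∈C , λ h∈S → h∉S' (h∈S , h≢β)

    sum-≢β : ∀ {x y} → S x → x ≢ β → S y → y ≢ β → x ⊕ y ≢ β
    sum-≢β {x} {y} x∈S x≢β y∈S y≢β x⊕y≡β with x ≟ₚ 𝟎 | y ≟ₚ 𝟎
    ... | yes refl | _        = y≢β (trans (sym (⊕-identityˡ y)) x⊕y≡β)
    ... | no _     | yes refl = x≢β (trans (sym (⊕-identityʳ x)) x⊕y≡β)
    ... | no x≢𝟎   | no y≢𝟎   = proj₂ (proj₂ β∈msg) (x , y , x∈S , x≢𝟎 , y∈S , y≢𝟎 , sym x⊕y≡β)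

    Remove-isCSemigroup : IsCSemigroup S'
    Remove-isCSemigroup = record
      { zero∈    = zero∈ , λ 𝟎≡β → β≢𝟎 (sym 𝟎≡β)
      ; closed   = λ (x∈S , x≢β) (y∈S , y≢β) → closed x∈S y∈S , sum-≢β x∈S x≢β y∈S y≢β
      ; ⊆C       = λ x∈S' → ⊆C (proj₁ x∈S')
      ; fingen   = G' , All-without S G⊆S β∈S closed β≢𝟎 ,
                   λ (x∈S , x≢β) → generated-without (generates x∈S) x≢β
      ; finHoles = β ∷ holes , hole-∈
      }
      where
      G : List (Pt d)
      G = proj₁ fingen
      G⊆S : All S G
      G⊆S = proj₁ (proj₂ fingen)
      generates : ∀ {x} → S x → Generated G x
      generates = proj₂ (proj₂ fingen)
      open WithoutGenerator G β

      holes : List (Pt d)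
      holes = proj₁ finHoles
      hole-∈ : ∀ {h} → Hole S' h → h ∈ β ∷ holes
      hole-∈ {h} h-hole with h ≟ₚ β
      ... | yes h≡β = here h≡β
      ... | no h≢β  = there (proj₂ finHoles (Hole-Remove⁻ h-hole h≢β))

    Remove-positioned : ∀ {k} → Positioned k S → (Σ (Pt d) λ s → S s × k ≡ β ⊕ s) → ¬ (β ⊕ β ≡ k) →
                        Positioned k S'
    Remove-positioned k-pos (s , s∈S , k≡β⊕s) β≢k/2 h h-hole with h ≟ₚ β
    ... | yes refl = s , (s∈S , λ s≡β → β≢k/2 (trans (cong (β ⊕_) (sym s≡β)) (sym k≡β⊕s))) , k≡β⊕s
    ... | no h≢β with k-pos h (Hole-Remove⁻ h-hole h≢β)
    ...   | s' , s'∈S , k≡h⊕s' = s' , (s'∈S , s'≢β) , k≡h⊕s'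
      where
      s'≢β : s' ≢ β
      s'≢β refl = proj₂ h-hole (subst S (⊕-cancelˡ β (trans (sym k≡β⊕s) (trans k≡h⊕s' (⊕-comm h β)))) s∈S , h≢β)

    CS-Remove : CS S β → ∀ x → CS S x ⇔ CS S' x
    CS-Remove (_ , h₀ , h₀-hole , β≤h₀) x = to , from
      where
      to : CS S x → CS S' x
      to (x∈C , h , h-hole , x≤h) = x∈C , h , Hole-Remove⁺ h-hole , x≤h

      from : CS S' x → CS S x
      from (x∈C , h , h-hole , x≤h) with h ≟ₚ β
      ... | yes refl = x∈C , h₀ , h₀-hole , ≤C-trans x≤h β≤h₀
      ... | no h≢β   = x∈C , h , Hole-Remove⁻ h-hole h≢β , x≤h

    -- A splitting β = y ⊕ c with 𝟎 ≠ y ≠ β, y ∈ S, makes c a hole of S (β is a minimal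
    -- generator), and then h = y ⊕ (c ⊕ t) with c ⊕ t a hole of S ∖ {β}.
    minimal-if-β⊕-splitsTrivially : ∀ {h t} → Hole S' h → SplitsTrivially S' h →
                                    Hole S t ⊎ t ≡ 𝟎 → h ≡ β ⊕ t → Minimal S β
    minimal-if-β⊕-splitsTrivially {h} {t} h-hole h-splits t-hole h≡β⊕t = β∈S , β≢𝟎 , below-β
      where
      below-β : ∀ y → S y → y ≢ 𝟎 → y ≤C β → y ≡ β
      below-β y y∈S y≢𝟎 (c , c∈C , β≡y⊕c) with y ≟ₚ β
      ... | yes y≡β = y≡β
      ... | no y≢β  = ⊥-elim (y≢𝟎 (h-splits y (y∈S , y≢β) (c ⊕ t , c⊕t-hole t-hole , h≡y⊕c⊕t)))
        where
        c≢𝟎 : c ≢ 𝟎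
        c≢𝟎 refl = y≢β (sym (trans β≡y⊕c (⊕-identityʳ y)))

        c∉S : ¬ S c
        c∉S c∈S = proj₂ (proj₂ β∈msg) (y , c , y∈S , y≢𝟎 , c∈S , c≢𝟎 , β≡y⊕c)

        h≡y⊕c⊕t : h ≡ y ⊕ (c ⊕ t)
        h≡y⊕c⊕t = begin
          h            ≡⟨ h≡β⊕t ⟩
          β ⊕ t        ≡⟨ cong (_⊕ t) β≡y⊕c ⟩
          (y ⊕ c) ⊕ t  ≡⟨ ⊕-assoc y c t ⟩
          y ⊕ (c ⊕ t)  ∎

        c⊕t-hole : Hole S t ⊎ t ≡ 𝟎 → Hole S' (c ⊕ t)
        c⊕t-hole (inj₂ refl) = subst (Hole S') (sym (⊕-identityʳ c)) (Hole-Remove⁺ (c∈C , c∉S))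
        c⊕t-hole (inj₁ (t∈C , t∉S)) = InCone-⊕ A {c} {t} c∈C t∈C , λ c⊕t∈S' →
          proj₂ h-hole (subst S (sym h≡y⊕c⊕t) (closed y∈S (proj₁ c⊕t∈S')) , h≢β)
          where
          h≢β : h ≢ β
          h≢β h≡β = t∉S (subst S (sym (x⊕y≡x⇒y≡𝟎 (trans (sym h≡β⊕t) h≡β))) zero∈)

    MS-Remove : ¬ Minimal S β → ∀ x → MS S x ⇔ MS S' x
    MS-Remove β-nonminimal x = to , from
      where
      to : MS S x → MS S' x
      to (inj₂ x≡𝟎)                 = inj₂ x≡𝟎
      to (inj₁ (x-hole , x-splits)) = inj₁ (Hole-Remove⁺ x-hole , splits')
        where
        splits' : SplitsTrivially S' x
        splits' s (s∈S , _) (t , t-hole , x≡s⊕t) with t ≟ₚ β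
        ... | yes refl = ⊥-elim (proj₂ x-hole (subst S (sym x≡s⊕t) (closed s∈S β∈S)))
        ... | no t≢β   = x-splits s s∈S (t , Hole-Remove⁻ t-hole t≢β , x≡s⊕t)

      from : MS S' x → MS S x
      from (inj₂ x≡𝟎)                 = inj₂ x≡𝟎
      from (inj₁ (x-hole , x-splits)) = inj₁ (Hole-Remove⁻ x-hole x≢β , splits)
        where
        x≢β : x ≢ β
        x≢β x≡β = β-nonminimal
          (minimal-if-β⊕-splitsTrivially x-hole x-splits (inj₂ refl) (trans x≡β (sym (⊕-identityʳ β))))

        splits : SplitsTrivially S x
        splits s s∈S (t , t-hole , x≡s⊕t) with s ≟ₚ β
        ... | yes refl = ⊥-elim (β-nonminimal
                           (minimal-if-β⊕-splitsTrivially x-hole x-splits (inj₁ t-hole) x≡s⊕t))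
        ... | no s≢β   = x-splits s (s∈S , s≢β) (t , Hole-Remove⁺ t-hole , x≡s⊕t)

proposition5p5 : (d : ℕ) (A : List (Pt d)) (T : TermOrder d) (k : Pt d) →
    Theory.C A T k →
    (S : Subset d) → Theory.P A T k S → ¬ Theory.EI A T k S →
    (β : Pt d) → Theory.B A T k S β →
    (∀ x → Theory.B A T k S x → TermOrder._≼_ T x β) →
    Theory.P A T k (Theory.Remove A T S β)
proposition5p5 d A T k _ S (S-cs , k-pos , a , b , c , |M| , |CS| , |I| , a+b≡c) _
               β (β∈msg , β∈CS , β-nonminimal , k-β∈S , β≢k/2) _ =
  Remove-isCSemigroup , Remove-positioned k-pos k-β∈S β≢k/2 , a , b , c ,
  HasCard-cong (MS-Remove β-nonminimal) |M| , HasCard-cong (CS-Remove β∈CS) |CS| , |I| , a+b≡c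
  where open Removal A T S S-cs β β∈msg
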